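{- Let $0<|q|<1$. For integers $r,s$ and $n\ge0$ define $$T_{r,n}(s)=\sum_{k=0}^n\frac{(q^{ -2n};q^2)_k}{(q;q)_k(q^{1+r-n};q)_k}q^{(2-s)k}.$$ Then for all integers $r,s$ and $n\ge0$ such that none of the factors $(q^{1+r-n};q)_k$ ($k\le n$), $(q^{r-n};q)_k$ ($k\le n+1$), $(q^{r-n-1};q)_k$ ($k\le n+2$) vanishes, $$q^{ -s}(1-q^{2n+2})(q^{ -s}+q^{r+n})T_{r,n}(s)+q^{n}(q^n-q^r)(-q^{2n+1}+q^{r+n}+q^{ -s}+q^{ -s-1})T_{r,n+1}(s)+q^{2n}(q^{n}-q^{r})(q^{n+1}-q^{r})T_{r,n+2}(s)=0.$$
   Context: For $x\in\mathbb{C}$ and integers $k\ge0$: $(x;q)_k=\prod_{j=0}^{k-1}(1-xq^j)$, and $(x;q^2)_k=\prod_{j=0}^{k-1}(1-xq^{2j})$. -}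

module Defs where

open import Level using (Level; _⊔_) renaming (suc to lsuc)
open import Data.Nat as ℕ using (ℕ; zero; suc)
open import Data.Integer as ℤ using (ℤ; +_; -[1+_])
open import Algebra.Bundles using (CommutativeRing)
open import Relation.Nullary using (¬_)

record Field (c ℓ : Level) : Set (lsuc (c ⊔ ℓ)) where
  field
    commutativeRing : CommutativeRing c ℓ
  open CommutativeRing commutativeRing public
  field
    _⁻¹      : Carrier → Carrier
    ⁻¹-inverse : ∀ x → ¬ (x ≈ 0#) → (x * (x ⁻¹)) ≈ 1#
    0≉1      : ¬ (0# ≈ 1#)

module FieldDefs {c ℓ : Level} (F : Field c ℓ) where
  open Field F using (Carrier; _+_; _*_; -_; _-_; 0#; 1#; _⁻¹)

  _^ℕ_ : Carrier → ℕ → Carrier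
  x ^ℕ zero = 1#
  x ^ℕ suc k = (x ^ℕ k) * x

  -- integer powers (meaningful for x ≠ 0)
  _^ℤ_ : Carrier → ℤ → Carrier
  x ^ℤ (+ k) = x ^ℕ k
  x ^ℤ (-[1+ k ]) = (x ⁻¹) ^ℕ (suc k)

  poch : Carrier → Carrier → ℕ → Carrier
  poch x b zero = 1#
  poch x b (suc k) = poch x b k * (1# - x * (b ^ℕ k))

  sumTo : (ℕ → Carrier) → ℕ → Carrier
  sumTo f zero = f zero
  sumTo f (suc n) = sumTo f n + f (suc n)

  T : Carrier → ℤ → ℕ → ℤ → Carrier
  T q r n s = sumTo (λ k →
      poch (q ^ℤ (ℤ.- (+ (2 ℕ.* n)))) (q ^ℕ 2) k
      * ((poch q q k * poch (q ^ℤ ((+ 1 ℤ.+ r) ℤ.- + n)) q k) ⁻¹)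
      * (q ^ℤ ((+ 2 ℤ.- s) ℤ.* + k))) n

{-# OPTIONS --safe #-}
module Submission where

open import Defs
open import Level using (Level; 0ℓ)
open import Data.Nat as ℕ using (ℕ; zero; suc; _≤_; _<_; z≤n; s≤s)
open import Data.Integer as ℤ using (ℤ; +_; -[1+_])
open import Relation.Nullary using (¬_; yes; no)
open import Data.Maybe using (Maybe; just; nothing)
open import Data.Sign as Sign using (Sign)
open import Data.Sum using (inj₁; inj₂)
open import Relation.Binary.PropositionalEquality as ≡ using (_≡_)
open import Algebra.Bundles using (CommutativeRing; RawRing)
open import Data.Integer.Tactic.RingSolver using (solve-∀)
import Data.Nat.Properties as ℕ
import Data.Integer.Properties as ℤ
import Algebra.Solver.Ring
import Algebra.Solver.Ring.AlmostCommutativeRing as ACR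

-- With ζ = q^(2-s), the sum T_{r,n+j}(s) is Σ_k t_j(k) ζ^k, where
-- t_j(k) = (q^(-2(n+j)); q²)_k / ((q;q)_k (q^(1+r-n-j); q)_k), and t₀, t₁ vanish just beyond the range
-- of their sums because (q^(-2n); q²)_(n+1) = 0. Hence q⁴ times the left-hand side is a polynomial in ζ
-- whose coefficient of ζ^m is a fixed linear combination of t₀(m-2), t₀(m-1), t₁(m-1), t₁(m), t₂(m),
-- with coefficients polynomial in q, q^(2n) and q^(r-n-1). The ratio t₁(m)/t₁(m-1) and the contiguity
-- relations between t_j(k+1) and t_(j-1)(k), both read off from
-- (x;b)_(k+1) = (x;b)_k (1 - x b^k) = (1 - x) (xb;b)_k, express the other four terms through t₁(m-1);
-- after clearing denominators the coefficient vanishes by an explicit polynomial identity (an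
-- ideal-membership certificate). The hypotheses on the Pochhammer symbols make the cleared denominators
-- nonzero. Two coefficients are special: the constant one is a polynomial identity by itself, and at
-- m = n+2 the factor 1 - q^(r+1) of the generic denominator may vanish, but there t₀(n+1) = t₁(n+2) = 0
-- and a smaller certificate applies.

module IntegerCoefficients {c ℓ : Level} (R : CommutativeRing c ℓ) where
  open CommutativeRing R
  open import Algebra.Properties.Ring ring using (-‿involutive; -‿distribˡ-*; -0#≈0#; -‿anti-homo-+)
  open import Algebra.Properties.Semiring.Mult.TCOptimised semiring using (_×_; ×-homo-+; ×1-homo-*; 1+×)
  open import Algebra.Properties.CommutativeSemigroup +-commutativeSemigroup
    using () renaming (interchange to +-interchange)
  open import Algebra.Properties.CommutativeSemigroup *-commutativeSemigroup
    using () renaming (interchange to *-interchange)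
  open import Relation.Binary.Reasoning.Setoid setoid

  ι : ℤ → Carrier
  ι (+ n)    = n × 1#
  ι -[1+ n ] = - (suc n × 1#)

  private
    ⟦_⟧ˢ : Sign → Carrier
    ⟦ Sign.+ ⟧ˢ = 1#
    ⟦ Sign.- ⟧ˢ = - 1#

    ⟦⟧ˢ-homo-* : ∀ s t → ⟦ s Sign.* t ⟧ˢ ≈ ⟦ s ⟧ˢ * ⟦ t ⟧ˢ
    ⟦⟧ˢ-homo-* Sign.+ t      = sym (*-identityˡ _)
    ⟦⟧ˢ-homo-* Sign.- Sign.+ = sym (*-identityʳ _)
    ⟦⟧ˢ-homo-* Sign.- Sign.- = begin
      1#            ≈⟨ -‿involutive 1# ⟨
      - - 1#        ≈⟨ -‿cong (*-identityˡ _) ⟨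
      - (1# * - 1#) ≈⟨ -‿distribˡ-* 1# _ ⟩
      - 1# * - 1#   ∎

    ι-◃ : ∀ s n → ι (s ℤ.◃ n) ≈ ⟦ s ⟧ˢ * (n × 1#)
    ι-◃ s      zero    = sym (zeroʳ _)
    ι-◃ Sign.+ (suc n) = sym (*-identityˡ _)
    ι-◃ Sign.- (suc n) = trans (-‿cong (sym (*-identityˡ _))) (-‿distribˡ-* 1# _)

    ι-sign-abs : ∀ i → ι i ≈ ⟦ ℤ.sign i ⟧ˢ * (ℤ.∣ i ∣ × 1#)
    ι-sign-abs i = trans (reflexive (≡.cong ι (≡.sym (ℤ.◃-inverse i)))) (ι-◃ (ℤ.sign i) ℤ.∣ i ∣)

    1+x-[1+y]≈x-y : ∀ x y → (1# + x) - (1# + y) ≈ x - y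
    1+x-[1+y]≈x-y x y = begin
      (1# + x) + - (1# + y)   ≈⟨ +-cong (+-comm 1# x) (-‿anti-homo-+ 1# y) ⟩
      (x + 1#) + (- y + - 1#) ≈⟨ +-interchange x 1# (- y) (- 1#) ⟩
      (x + - y) + (1# + - 1#) ≈⟨ +-congˡ (-‿inverseʳ 1#) ⟩
      (x + - y) + 0#          ≈⟨ +-identityʳ _ ⟩
      x - y                   ∎

    ι-⊖ : ∀ m n → ι (m ℤ.⊖ n) ≈ m × 1# - n × 1#
    ι-⊖ zero    zero    = sym (-‿inverseʳ 0#)
    ι-⊖ (suc m) zero    = sym (trans (+-congˡ -0#≈0#) (+-identityʳ _))
    ι-⊖ zero    (suc n) = sym (+-identityˡ _)
    ι-⊖ (suc m) (suc n) = begin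
      ι (suc m ℤ.⊖ suc n)           ≡⟨ ≡.cong ι (ℤ.[1+m]⊖[1+n]≡m⊖n m n) ⟩
      ι (m ℤ.⊖ n)                   ≈⟨ ι-⊖ m n ⟩
      m × 1# - n × 1#               ≈⟨ 1+x-[1+y]≈x-y (m × 1#) (n × 1#) ⟨
      (1# + m × 1#) - (1# + n × 1#) ≈⟨ +-cong (1+× m 1#) (-‿cong (1+× n 1#)) ⟨
      suc m × 1# - suc n × 1#       ∎

  ι-+ : ∀ i j → ι (i ℤ.+ j) ≈ ι i + ι j
  ι-+ (+ m)    (+ n)    = ×-homo-+ 1# m n
  ι-+ (+ m)    -[1+ n ] = ι-⊖ m (suc n)
  ι-+ -[1+ m ] (+ n)    = trans (ι-⊖ n (suc m)) (+-comm _ _)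
  ι-+ -[1+ m ] -[1+ n ] = begin
    - (suc (suc (m ℕ.+ n)) × 1#)    ≡⟨ ≡.cong (λ k → - (suc k × 1#)) (ℕ.+-suc m n) ⟨
    - ((suc m ℕ.+ suc n) × 1#)      ≈⟨ -‿cong (×-homo-+ 1# (suc m) (suc n)) ⟩
    - (suc m × 1# + suc n × 1#)     ≈⟨ -‿anti-homo-+ _ _ ⟩
    - (suc n × 1#) + - (suc m × 1#) ≈⟨ +-comm _ _ ⟩
    - (suc m × 1#) + - (suc n × 1#) ∎

  ι-* : ∀ i j → ι (i ℤ.* j) ≈ ι i * ι j
  ι-* i j = begin
    ι (i ℤ.* j)
      ≈⟨ ι-◃ (ℤ.sign i Sign.* ℤ.sign j) (ℤ.∣ i ∣ ℕ.* ℤ.∣ j ∣) ⟩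
    ⟦ ℤ.sign i Sign.* ℤ.sign j ⟧ˢ * ((ℤ.∣ i ∣ ℕ.* ℤ.∣ j ∣) × 1#)
      ≈⟨ *-cong (⟦⟧ˢ-homo-* (ℤ.sign i) (ℤ.sign j)) (×1-homo-* ℤ.∣ i ∣ ℤ.∣ j ∣) ⟩
    (⟦ ℤ.sign i ⟧ˢ * ⟦ ℤ.sign j ⟧ˢ) * ((ℤ.∣ i ∣ × 1#) * (ℤ.∣ j ∣ × 1#))
      ≈⟨ *-interchange _ _ _ _ ⟩
    (⟦ ℤ.sign i ⟧ˢ * (ℤ.∣ i ∣ × 1#)) * (⟦ ℤ.sign j ⟧ˢ * (ℤ.∣ j ∣ × 1#))
      ≈⟨ *-cong (ι-sign-abs i) (ι-sign-abs j) ⟨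
    ι i * ι j ∎

  ι-neg : ∀ i → ι (ℤ.- i) ≈ - ι i
  ι-neg (+ zero)  = sym -0#≈0#
  ι-neg (+ suc n) = refl
  ι-neg -[1+ n ]  = sym (-‿involutive _)

  ι-homomorphism : ℤ.+-*-rawRing ACR.-Raw-AlmostCommutative⟶ ACR.fromCommutativeRing R
  ι-homomorphism = record
    { ⟦_⟧    = ι
    ; +-homo = ι-+
    ; *-homo = ι-*
    ; -‿homo = ι-neg
    ; 0-homo = refl
    ; 1-homo = refl
    }

  ι-≈? : ∀ i j → Maybe (ι i ≈ ι j)
  ι-≈? i j with i ℤ.≟ j
  ... | yes ≡.refl = just refl
  ... | no _       = nothing

  open Algebra.Solver.Ring ℤ.+-*-rawRing (ACR.fromCommutativeRing R) ι-homomorphism ι-≈?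
    public using (solve; Polynomial; con; _:+_; _:*_; _:-_; :-_; _:=_)

  -- Instantiating the generic expressions of Polynomials at this raw ring gives solver syntax
  -- whose semantics is definitionally the same expression in R, so each expression is written once.
  polynomialRawRing : ℕ → RawRing 0ℓ 0ℓ
  polynomialRawRing n = record
    { Carrier = Polynomial n
    ; _≈_     = _≡_
    ; _+_     = _:+_
    ; _*_     = _:*_
    ; -_      = :-_
    ; 0#      = con (+ 0)
    ; 1#      = con (+ 1)
    }

-- Variables: W = q^n, Ω = W² = q^(2n), Y = q^(r-n-1), v = q^j and e = q^(-s-1), so that ζ = e q³.
-- ca, …, ce are the coefficients of ζ²T_n, ζT_n, ζT_(n+1), T_(n+1), T_(n+2) in q⁴ times the left-hand side.
module Polynomials {c ℓ : Level} (R : RawRing c ℓ) where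
  open RawRing R

  infixl 6 _-_
  _-_ : Carrier → Carrier → Carrier
  x - y = x + - y

  ca cb cc cd ce : (q Ω Y : Carrier) → Carrier
  ca q Ω Y = 1# - Ω * q * q
  cb q Ω Y = ca q Ω Y * (Ω * Y * q * q * q)
  cc q Ω Y = Ω * (1# - Y * q) * (q * q + q)
  cd q Ω Y = Ω * Ω * q * q * q * q * q * (1# - Y * q) * (Y - 1#)
  ce q Ω Y = Ω * Ω * q * q * q * q * q * (1# - Y * q) * (1# - Y)

  combination : (q Ω Y u₁ u₂ u₃ u₄ u₅ : Carrier) → Carrier
  combination q Ω Y u₁ u₂ u₃ u₄ u₅ =
    ca q Ω Y * u₁ + cb q Ω Y * u₂ + cc q Ω Y * u₃ + cd q Ω Y * u₄ + ce q Ω Y * u₅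

  lhs : (e q W Y T₀ T₁ T₂ : Carrier) → Carrier
  lhs e q W Y T₀ T₁ T₂ =
      e * q * (1# - W * W * q * q) * (e * q + W * q * Y * W) * T₀
    + W * (W - W * q * Y) * (- (W * W * q) + W * q * Y * W + e * q + e) * T₁
    + W * W * (W - W * q * Y) * (W * q - W * q * Y) * T₂

  expansion : (e q W Y T₀ T₁ T₂ : Carrier) → Carrier
  expansion e q W Y T₀ T₁ T₂ = combination q (W * W) Y (ζ * (ζ * T₀)) (ζ * T₀) (ζ * T₁) T₁ T₂
    where
    ζ : Carrier
    ζ = e * q * q * q

  -- clearing · combination = certificate identically (likewise for the ᵗᵒᵖ variants, where u₂ = u₄ = 0),
  -- and each summand of a certificate is a multiple of (left - right side) of one hypothesis of
  -- combination-vanishes(ᵗᵒᵖ).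
  clearing : (q v Ω Y : Carrier) → Carrier
  clearing q v Ω Y = (Ω * q * q - 1#) * (1# - q * v) * (1# - Y) * (1# - Y * q * v) * (Ω * q * q * q * q)

  certificate : (q v Ω Y u₁ u₂ u₃ u₄ u₅ : Carrier) → Carrier
  certificate q v Ω Y u₁ u₂ u₃ u₄ u₅ =
      ca q Ω Y * ((1# - q * v) * (1# - Y) * (1# - Y * q * v) * (Ω * q * q * q * q))
        * (u₁ * (Ω * q * q - 1#) - u₃ * ((1# - v) * (1# - Y * q) * (Ω * q * q)))
    + cb q Ω Y * ((1# - q * v) * (1# - Y) * (Ω * q * q * q * q))
        * (u₂ * ((Ω * q * q - 1#) * (1# - Y * q * v)) - u₃ * ((Ω * q * q - v * v) * (1# - Y * q)))
    + cd q Ω Y * ((Ω * q * q - 1#) * (1# - Y) * (q * q))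
        * (u₄ * ((1# - q * v) * (1# - Y * q * v) * (Ω * q * q)) - u₃ * (Ω * q * q - v * v))
    + ce q Ω Y * ((Ω * q * q - 1#) * (1# - Y * q * v))
        * (u₅ * ((1# - q * v) * (1# - Y) * (Ω * q * q * q * q)) - u₃ * (Ω * q * q * q * q - 1#))

  clearingᵗᵒᵖ : (q W Y : Carrier) → Carrier
  clearingᵗᵒᵖ q W Y = (W * W * q * q - 1#) * (1# - q * (W * q)) * (1# - Y) * (W * W * q * q * q * q)

  certificateᵗᵒᵖ : (q W Y u₁ u₃ u₅ : Carrier) → Carrier
  certificateᵗᵒᵖ q W Y u₁ u₃ u₅ =
      ca q (W * W) Y * ((1# - q * (W * q)) * (1# - Y) * (W * W * q * q * q * q))
        * (u₁ * (W * W * q * q - 1#) - u₃ * ((1# - W * q) * (1# - Y * q) * (W * W * q * q)))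
    + ce q (W * W) Y * (W * W * q * q - 1#)
        * (u₅ * ((1# - q * (W * q)) * (1# - Y) * (W * W * q * q * q * q)) - u₃ * (W * W * q * q * q * q - 1#))

module FieldProperties {c ℓ : Level} (F : Field c ℓ) where
  open Field F hiding (zero)
  open IntegerCoefficients commutativeRing using (solve; _:=_; _:*_; _:-_; con)
  open import Algebra.Properties.Group +-group using (x∙y⁻¹≈ε⇒x≈y)
  open import Algebra.Properties.CommutativeSemigroup *-commutativeSemigroup using (xy∙z≈xz∙y)
  open import Relation.Binary.Reasoning.Setoid setoid

  1≉0 : 1# ≉ 0#
  1≉0 1≈0 = 0≉1 (sym 1≈0)

  ≉0-resp : ∀ {x y} → x ≈ y → x ≉ 0# → y ≉ 0#
  ≉0-resp x≈y x≉0 y≈0 = x≉0 (trans x≈y y≈0)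

  x*y≈0⇒y≈0 : ∀ {x y} → x ≉ 0# → x * y ≈ 0# → y ≈ 0#
  x*y≈0⇒y≈0 {x} {y} x≉0 xy≈0 = begin
    y                  ≈⟨ *-identityˡ y ⟨
    1# * y             ≈⟨ *-congʳ (trans (*-comm _ _) (⁻¹-inverse x x≉0)) ⟨
    (x ⁻¹ * x) * y     ≈⟨ *-assoc _ _ _ ⟩
    x ⁻¹ * (x * y)     ≈⟨ *-congˡ xy≈0 ⟩
    x ⁻¹ * 0#          ≈⟨ zeroʳ _ ⟩
    0#                 ∎

  *-≉0 : ∀ {x y} → x ≉ 0# → y ≉ 0# → x * y ≉ 0#
  *-≉0 x≉0 y≉0 xy≈0 = y≉0 (x*y≈0⇒y≈0 x≉0 xy≈0)

  *-≉0ˡ : ∀ {x y} → x * y ≉ 0# → x ≉ 0#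
  *-≉0ˡ xy≉0 x≈0 = xy≉0 (trans (*-congʳ x≈0) (zeroˡ _))

  *-≉0ʳ : ∀ {x y} → x * y ≉ 0# → y ≉ 0#
  *-≉0ʳ xy≉0 y≈0 = xy≉0 (trans (*-congˡ y≈0) (zeroʳ _))

  x≈1⇒x⁻¹≈1 : ∀ {x} → x ≈ 1# → x ⁻¹ ≈ 1#
  x≈1⇒x⁻¹≈1 {x} x≈1 = begin
    x ⁻¹       ≈⟨ *-identityˡ _ ⟨
    1# * x ⁻¹  ≈⟨ *-congʳ x≈1 ⟨
    x * x ⁻¹   ≈⟨ ⁻¹-inverse x (λ x≈0 → 0≉1 (trans (sym x≈0) x≈1)) ⟩
    1#         ∎

  -- _⁻¹ is not known to be a congruence, so d′ is related to d * c by a hypothesis.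
  ⁻¹-cancel-factor : ∀ {x d c d′} → d′ ≉ 0# → d′ ≈ d * c → x * d′ ⁻¹ * c ≈ x * d ⁻¹
  ⁻¹-cancel-factor {x} {d} {c} {d′} d′≉0 d′≈dc = begin
    x * d′ ⁻¹ * c                        ≈⟨ *-identityʳ _ ⟨
    x * d′ ⁻¹ * c * 1#                   ≈⟨ *-congˡ (⁻¹-inverse d d≉0) ⟨
    x * d′ ⁻¹ * c * (d * d ⁻¹)           ≈⟨ solve 5 (λ x d′⁻¹ c d d⁻¹ →
                                              x :* d′⁻¹ :* c :* (d :* d⁻¹) := x :* d⁻¹ :* (d :* c :* d′⁻¹))
                                            refl x (d′ ⁻¹) c d (d ⁻¹) ⟩
    x * d ⁻¹ * (d * c * d′ ⁻¹)           ≈⟨ *-congˡ (*-congʳ d′≈dc) ⟨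
    x * d ⁻¹ * (d′ * d′ ⁻¹)              ≈⟨ *-congˡ (⁻¹-inverse d′ d′≉0) ⟩
    x * d ⁻¹ * 1#                        ≈⟨ *-identityʳ _ ⟩
    x * d ⁻¹                             ∎
    where
    d≉0 : d ≉ 0#
    d≉0 = *-≉0ˡ (≉0-resp d′≈dc d′≉0)

  x≉1⇒1-x≉0 : ∀ {x} → x ≉ 1# → 1# - x ≉ 0#
  x≉1⇒1-x≉0 x≉1 1-x≈0 = x≉1 (sym (x∙y⁻¹≈ε⇒x≈y _ _ 1-x≈0))

  x≉1⇒x-1≉0 : ∀ {x} → x ≉ 1# → x - 1# ≉ 0#
  x≉1⇒x-1≉0 x≉1 x-1≈0 = x≉1 (x∙y⁻¹≈ε⇒x≈y _ _ x-1≈0)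

  x*[y*z]*w≈x*[y*w]*z : ∀ x y z w → x * (y * z) * w ≈ x * (y * w) * z
  x*[y*z]*w≈x*[y*w]*z x y z w = begin
    x * (y * z) * w     ≈⟨ *-assoc x _ w ⟩
    x * (y * z * w)     ≈⟨ *-congˡ (xy∙z≈xz∙y y z w) ⟩
    x * (y * w * z)     ≈⟨ *-assoc x _ z ⟨
    x * (y * w) * z     ∎

  [1-u]*p≈p-1 : ∀ {u p} → u * p ≈ 1# → (1# - u) * p ≈ p - 1#
  [1-u]*p≈p-1 {u} {p} up≈1 = begin
    (1# - u) * p   ≈⟨ solve 2 (λ u p → (con (+ 1) :- u) :* p := p :- u :* p) refl u p ⟩
    p - u * p      ≈⟨ +-congˡ (-‿cong up≈1) ⟩
    p - 1#         ∎

  [1-u*w]*p≈p-w : ∀ {u p} w → u * p ≈ 1# → (1# - u * w) * p ≈ p - w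
  [1-u*w]*p≈p-w {u} {p} w up≈1 = begin
    (1# - u * w) * p   ≈⟨ solve 3 (λ u w p → (con (+ 1) :- u :* w) :* p := p :- u :* p :* w) refl u w p ⟩
    p - u * p * w      ≈⟨ +-congˡ (-‿cong (*-congʳ up≈1)) ⟩
    p - 1# * w         ≈⟨ +-congˡ (-‿cong (*-identityˡ w)) ⟩
    p - w              ∎

module Powers {c ℓ : Level} (F : Field c ℓ) where
  open Field F hiding (zero)
  open FieldDefs F
  open FieldProperties F
  open import Algebra.Properties.CommutativeSemiring.Exp commutativeSemiring using (_^_; ^-homo-*; ^-distrib-*)
  open import Algebra.Properties.CommutativeSemigroup *-commutativeSemigroup
    using () renaming (interchange to *-interchange)
  open import Relation.Binary.Reasoning.Setoid setoid

  ^ℕ≈^ : ∀ x k → x ^ℕ k ≈ x ^ k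
  ^ℕ≈^ x zero    = refl
  ^ℕ≈^ x (suc k) = trans (*-comm _ x) (*-congˡ (^ℕ≈^ x k))

  ^ℕ-cong : ∀ {x y} k → x ≈ y → x ^ℕ k ≈ y ^ℕ k
  ^ℕ-cong zero    x≈y = refl
  ^ℕ-cong (suc k) x≈y = *-cong (^ℕ-cong k x≈y) x≈y

  ^ℕ-+ : ∀ x m k → x ^ℕ (m ℕ.+ k) ≈ x ^ℕ m * x ^ℕ k
  ^ℕ-+ x m k = begin
    x ^ℕ (m ℕ.+ k)    ≈⟨ ^ℕ≈^ x (m ℕ.+ k) ⟩
    x ^ (m ℕ.+ k)     ≈⟨ ^-homo-* x m k ⟩
    x ^ m * x ^ k     ≈⟨ *-cong (^ℕ≈^ x m) (^ℕ≈^ x k) ⟨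
    x ^ℕ m * x ^ℕ k   ∎

  ^ℕ-distrib-* : ∀ x y k → (x * y) ^ℕ k ≈ x ^ℕ k * y ^ℕ k
  ^ℕ-distrib-* x y k = begin
    (x * y) ^ℕ k      ≈⟨ ^ℕ≈^ (x * y) k ⟩
    (x * y) ^ k       ≈⟨ ^-distrib-* x y k ⟩
    x ^ k * y ^ k     ≈⟨ *-cong (^ℕ≈^ x k) (^ℕ≈^ y k) ⟨
    x ^ℕ k * y ^ℕ k   ∎

  ^ℕ-≉0 : ∀ {x} k → x ≉ 0# → x ^ℕ k ≉ 0#
  ^ℕ-≉0 zero    x≉0 = 1≉0
  ^ℕ-≉0 (suc k) x≉0 = *-≉0 (^ℕ-≉0 k x≉0) x≉0

  module _ {q : Carrier} (q≉0 : q ≉ 0#) where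

    private
      ^ℤ-⊖ : ∀ m k → q ^ℤ (m ℤ.⊖ k) ≈ q ^ℕ m * (q ⁻¹) ^ℕ k
      ^ℤ-⊖ zero    zero    = sym (*-identityˡ 1#)
      ^ℤ-⊖ (suc m) zero    = sym (*-identityʳ _)
      ^ℤ-⊖ zero    (suc k) = sym (*-identityˡ _)
      ^ℤ-⊖ (suc m) (suc k) = begin
        q ^ℤ (suc m ℤ.⊖ suc k)              ≡⟨ ≡.cong (q ^ℤ_) (ℤ.[1+m]⊖[1+n]≡m⊖n m k) ⟩
        q ^ℤ (m ℤ.⊖ k)                      ≈⟨ ^ℤ-⊖ m k ⟩
        q ^ℕ m * (q ⁻¹) ^ℕ k                ≈⟨ *-identityʳ _ ⟨
        q ^ℕ m * (q ⁻¹) ^ℕ k * 1#           ≈⟨ *-congˡ (⁻¹-inverse q q≉0) ⟨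
        q ^ℕ m * (q ⁻¹) ^ℕ k * (q * q ⁻¹)   ≈⟨ *-interchange _ _ _ _ ⟩
        q ^ℕ m * q * ((q ⁻¹) ^ℕ k * q ⁻¹)   ∎

    ^ℤ-+ : ∀ i j → q ^ℤ (i ℤ.+ j) ≈ q ^ℤ i * q ^ℤ j
    ^ℤ-+ (+ m)    (+ k)    = ^ℕ-+ q m k
    ^ℤ-+ (+ m)    -[1+ k ] = ^ℤ-⊖ m (suc k)
    ^ℤ-+ -[1+ m ] (+ k)    = trans (^ℤ-⊖ k (suc m)) (*-comm _ _)
    ^ℤ-+ -[1+ m ] -[1+ k ] = begin
      (q ⁻¹) ^ℕ suc (suc (m ℕ.+ k))       ≡⟨ ≡.cong (λ l → (q ⁻¹) ^ℕ suc l) (ℕ.+-suc m k) ⟨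
      (q ⁻¹) ^ℕ (suc m ℕ.+ suc k)         ≈⟨ ^ℕ-+ (q ⁻¹) (suc m) (suc k) ⟩
      (q ⁻¹) ^ℕ suc m * (q ⁻¹) ^ℕ suc k   ∎

    ^ℤ-*-+ : ∀ i k → q ^ℤ (i ℤ.* + k) ≈ (q ^ℤ i) ^ℕ k
    ^ℤ-*-+ i zero    = reflexive (≡.cong (q ^ℤ_) (ℤ.*-zeroʳ i))
    ^ℤ-*-+ i (suc k) = begin
      q ^ℤ (i ℤ.* + suc k)          ≡⟨ ≡.cong (q ^ℤ_) (ℤ.*-suc i (+ k)) ⟩
      q ^ℤ (i ℤ.+ i ℤ.* + k)        ≈⟨ ^ℤ-+ i (i ℤ.* + k) ⟩
      q ^ℤ i * q ^ℤ (i ℤ.* + k)     ≈⟨ *-congˡ (^ℤ-*-+ i k) ⟩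
      q ^ℤ i * (q ^ℤ i) ^ℕ k        ≈⟨ *-comm _ _ ⟩
      (q ^ℤ i) ^ℕ k * q ^ℤ i        ∎

    ^ℤ-+-≡ : ∀ i j {k} → i ℤ.+ j ≡ k → q ^ℤ i * q ^ℤ j ≈ q ^ℤ k
    ^ℤ-+-≡ i j ≡.refl = sym (^ℤ-+ i j)

module Pochhammer {c ℓ : Level} (F : Field c ℓ) where
  open Field F hiding (zero)
  open FieldDefs F
  open FieldProperties F
  open IntegerCoefficients commutativeRing using (solve; _:=_; _:*_; _:-_; con)
  open import Relation.Binary.Reasoning.Setoid setoid

  poch-cong : ∀ {y y′} b k → y ≈ y′ → poch y b k ≈ poch y′ b k
  poch-cong b zero    y≈y′ = refl
  poch-cong b (suc k) y≈y′ = *-cong (poch-cong b k y≈y′) (+-congˡ (-‿cong (*-congʳ y≈y′)))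

  poch-unfoldˡ : ∀ y b k → poch y b (suc k) ≈ (1# - y) * poch (y * b) b k
  poch-unfoldˡ y b zero    =
    solve 1 (λ y → con (+ 1) :* (con (+ 1) :- y :* con (+ 1)) := (con (+ 1) :- y) :* con (+ 1)) refl y
  poch-unfoldˡ y b (suc k) = begin
    poch y b (suc k) * (1# - y * (b ^ℕ k * b))              ≈⟨ *-congʳ (poch-unfoldˡ y b k) ⟩
    (1# - y) * poch (y * b) b k * (1# - y * (b ^ℕ k * b))   ≈⟨ solve 4 (λ y b P B →
                                                                 (con (+ 1) :- y) :* P :* (con (+ 1) :- y :* (B :* b))
                                                                 := (con (+ 1) :- y) :* (P :* (con (+ 1) :- y :* b :* B)))
                                                               refl y b (poch (y * b) b k) (b ^ℕ k) ⟩
    (1# - y) * (poch (y * b) b k * (1# - y * b * b ^ℕ k))   ∎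

  poch-≈0 : ∀ {y b} k → y * b ^ℕ k ≈ 1# → poch y b (suc k) ≈ 0#
  poch-≈0 k y*bᵏ≈1 = trans (*-congˡ (trans (+-congˡ (-‿cong y*bᵏ≈1)) (-‿inverseʳ 1#))) (zeroʳ _)

  poch-q-≉0 : ∀ {q} → (∀ j → 0 < j → q ^ℕ j ≉ 1#) → ∀ k → poch q q k ≉ 0#
  poch-q-≉0 no-root zero    = 1≉0
  poch-q-≉0 no-root (suc k) = *-≉0 (poch-q-≉0 no-root k)
    (x≉1⇒1-x≉0 (λ q*qᵏ≈1 → no-root (suc k) (s≤s z≤n) (trans (*-comm _ _) q*qᵏ≈1)))

module HypergeometricTerm {c ℓ : Level} (F : Field c ℓ) (q : Field.Carrier F) where
  open Field F hiding (zero)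
  open FieldDefs F
  open FieldProperties F
  open Pochhammer F
  open IntegerCoefficients commutativeRing using (solve; _:=_; _:*_; _:-_; con)
  open import Algebra.Properties.CommutativeSemigroup *-commutativeSemigroup
    using (xy∙z≈y∙xz; x∙yz≈yx∙z) renaming (interchange to *-interchange)
  open import Relation.Binary.Reasoning.Setoid setoid

  denominator : Carrier → ℕ → Carrier
  denominator Y k = poch q q k * poch Y q k

  term : (b U Y : Carrier) → ℕ → Carrier
  term b U Y k = poch U b k * denominator Y k ⁻¹

  term-zero : ∀ b U Y → term b U Y 0 ≈ 1#
  term-zero b U Y = trans (*-identityˡ _) (x≈1⇒x⁻¹≈1 (*-identityˡ 1#))

  term-≈0 : ∀ {b U} Y k → U * b ^ℕ k ≈ 1# → term b U Y (suc k) ≈ 0#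
  term-≈0 Y k U*bᵏ≈1 = trans (*-congʳ (poch-≈0 k U*bᵏ≈1)) (zeroˡ _)

  term-suc : ∀ b U Y k → denominator Y (suc k) ≉ 0# →
    term b U Y (suc k) * ((1# - q * q ^ℕ k) * (1# - Y * q ^ℕ k)) ≈ (1# - U * b ^ℕ k) * term b U Y k
  term-suc b U Y k den≉0 = begin
    poch U b (suc k) * denominator Y (suc k) ⁻¹ * ((1# - q * q ^ℕ k) * (1# - Y * q ^ℕ k))
      ≈⟨ ⁻¹-cancel-factor den≉0 (*-interchange _ _ _ _) ⟩
    poch U b k * (1# - U * b ^ℕ k) * denominator Y k ⁻¹
      ≈⟨ xy∙z≈y∙xz (poch U b k) (1# - U * b ^ℕ k) (denominator Y k ⁻¹) ⟩
    (1# - U * b ^ℕ k) * term b U Y k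
      ∎

  term-shift : ∀ {b U U′ Y Y′} k → U * b ≈ U′ → Y * q ≈ Y′ → denominator Y (suc k) ≉ 0# →
    term b U Y (suc k) * ((1# - q * q ^ℕ k) * (1# - Y)) ≈ (1# - U) * term b U′ Y′ k
  term-shift {b} {U} {U′} {Y} {Y′} k Ub≈U′ Yq≈Y′ den≉0 = begin
    poch U b (suc k) * denominator Y (suc k) ⁻¹ * ((1# - q * q ^ℕ k) * (1# - Y))
      ≈⟨ ⁻¹-cancel-factor den≉0 den-unfold ⟩
    poch U b (suc k) * denominator Y′ k ⁻¹
      ≈⟨ *-congʳ (trans (poch-unfoldˡ U b k) (*-congˡ (poch-cong b k Ub≈U′))) ⟩
    (1# - U) * poch U′ b k * denominator Y′ k ⁻¹
      ≈⟨ *-assoc _ _ _ ⟩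
    (1# - U) * term b U′ Y′ k
      ∎
    where
    den-unfold : denominator Y (suc k) ≈ denominator Y′ k * ((1# - q * q ^ℕ k) * (1# - Y))
    den-unfold = begin
      poch q q k * (1# - q * q ^ℕ k) * poch Y q (suc k)
        ≈⟨ *-congˡ (trans (poch-unfoldˡ Y q k) (*-congˡ (poch-cong q k Yq≈Y′))) ⟩
      poch q q k * (1# - q * q ^ℕ k) * ((1# - Y) * poch Y′ q k)
        ≈⟨ solve 4 (λ p a b p′ → p :* a :* (b :* p′) := p :* p′ :* (a :* b))
             refl (poch q q k) (1# - q * q ^ℕ k) (1# - Y) (poch Y′ q k) ⟩
      denominator Y′ k * ((1# - q * q ^ℕ k) * (1# - Y))
        ∎

  term-contiguous : ∀ {b U U′ Y Y′} k → U * b ≈ U′ → Y * q ≈ Y′ → denominator Y (suc k) ≉ 0# →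
    term b U′ Y′ k * ((1# - U) * (1# - Y * q ^ℕ k)) ≈ term b U Y k * ((1# - U * b ^ℕ k) * (1# - Y))
  term-contiguous {b} {U} {U′} {Y} {Y′} k Ub≈U′ Yq≈Y′ den≉0 = begin
    term b U′ Y′ k * ((1# - U) * (1# - Y * q ^ℕ k))
      ≈⟨ x∙yz≈yx∙z (term b U′ Y′ k) (1# - U) (1# - Y * q ^ℕ k) ⟩
    (1# - U) * term b U′ Y′ k * (1# - Y * q ^ℕ k)
      ≈⟨ *-congʳ (term-shift k Ub≈U′ Yq≈Y′ den≉0) ⟨
    term b U Y (suc k) * ((1# - q * q ^ℕ k) * (1# - Y)) * (1# - Y * q ^ℕ k)
      ≈⟨ x*[y*z]*w≈x*[y*w]*z (term b U Y (suc k)) (1# - q * q ^ℕ k) (1# - Y) (1# - Y * q ^ℕ k) ⟩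
    term b U Y (suc k) * ((1# - q * q ^ℕ k) * (1# - Y * q ^ℕ k)) * (1# - Y)
      ≈⟨ *-congʳ (term-suc b U Y k den≉0) ⟩
    (1# - U * b ^ℕ k) * term b U Y k * (1# - Y)
      ≈⟨ xy∙z≈y∙xz (1# - U * b ^ℕ k) (term b U Y k) (1# - Y) ⟩
    term b U Y k * ((1# - U * b ^ℕ k) * (1# - Y))
      ∎

module Series {c ℓ : Level} (F : Field c ℓ) where
  open Field F hiding (zero)
  open FieldDefs F
  open IntegerCoefficients commutativeRing using (solve; _:=_; _:*_; _:+_; con)
  open import Relation.Binary.Reasoning.Setoid setoid

  shift : (ℕ → Carrier) → ℕ → Carrier
  shift a zero    = 0#
  shift a (suc m) = a m

  series : (ℕ → Carrier) → Carrier → ℕ → Carrier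
  series a z = sumTo (λ k → a k * z ^ℕ k)

  sumTo-cong : ∀ {f g : ℕ → Carrier} N → (∀ k → k ≤ N → f k ≈ g k) → sumTo f N ≈ sumTo g N
  sumTo-cong zero    f≈g = f≈g zero z≤n
  sumTo-cong (suc N) f≈g =
    +-cong (sumTo-cong N (λ k k≤N → f≈g k (ℕ.m≤n⇒m≤1+n k≤N))) (f≈g (suc N) ℕ.≤-refl)

  series-≈0 : ∀ {a : ℕ → Carrier} z N → (∀ k → k ≤ N → a k ≈ 0#) → series a z N ≈ 0#
  series-≈0 z zero    a≈0 = trans (*-congʳ (a≈0 zero z≤n)) (zeroˡ _)
  series-≈0 z (suc N) a≈0 = trans (+-cong (series-≈0 z N (λ k k≤N → a≈0 k (ℕ.m≤n⇒m≤1+n k≤N)))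
                                          (trans (*-congʳ (a≈0 (suc N) ℕ.≤-refl)) (zeroˡ _)))
                                  (+-identityʳ 0#)

  series-extend : ∀ (a : ℕ → Carrier) z N → a (suc N) ≈ 0# → series a z (suc N) ≈ series a z N
  series-extend a z N aₙ₊₁≈0 = trans (+-congˡ (trans (*-congʳ aₙ₊₁≈0) (zeroˡ _))) (+-identityʳ _)

  series-shift : ∀ (a : ℕ → Carrier) z N → z * series a z N ≈ series (shift a) z (suc N)
  series-shift a z zero    =
    solve 2 (λ z a → z :* (a :* con (+ 1)) := con (+ 0) :* con (+ 1) :+ a :* (con (+ 1) :* z)) refl z (a zero)
  series-shift a z (suc N) = begin
    z * (series a z N + a (suc N) * (z ^ℕ N * z))
      ≈⟨ distribˡ z _ _ ⟩
    z * series a z N + z * (a (suc N) * (z ^ℕ N * z))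
      ≈⟨ +-cong (series-shift a z N)
                (solve 3 (λ z a Z → z :* (a :* (Z :* z)) := a :* (Z :* z :* z)) refl z (a (suc N)) (z ^ℕ N)) ⟩
    series (shift a) z (suc N) + a (suc N) * (z ^ℕ N * z * z)
      ∎

module Coefficients {c ℓ : Level} (F : Field c ℓ) where
  open Field F hiding (zero)
  open FieldDefs F
  open FieldProperties F
  open Series F
  open IntegerCoefficients commutativeRing using (solve; _:=_; _:*_; _:+_; con; polynomialRawRing)
  open Polynomials rawRing
    using (combination; lhs; expansion; clearing; certificate; clearingᵗᵒᵖ; certificateᵗᵒᵖ)
  module P {n} = Polynomials (polynomialRawRing n)
  open import Algebra.Properties.Group +-group using (x≈y⇒x∙y⁻¹≈ε)
  open import Relation.Binary.Reasoning.Setoid setoid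

  combination-cong : ∀ q Ω Y {u₁ u₂ u₃ u₄ u₅ w₁ w₂ w₃ w₄ w₅} →
    u₁ ≈ w₁ → u₂ ≈ w₂ → u₃ ≈ w₃ → u₄ ≈ w₄ → u₅ ≈ w₅ →
    combination q Ω Y u₁ u₂ u₃ u₄ u₅ ≈ combination q Ω Y w₁ w₂ w₃ w₄ w₅
  combination-cong q Ω Y e₁ e₂ e₃ e₄ e₅ =
    +-cong (+-cong (+-cong (+-cong (*-congˡ e₁) (*-congˡ e₂)) (*-congˡ e₃)) (*-congˡ e₄)) (*-congˡ e₅)

  combination-+ : ∀ q Ω Y u₁ u₂ u₃ u₄ u₅ w₁ w₂ w₃ w₄ w₅ →
    combination q Ω Y (u₁ + w₁) (u₂ + w₂) (u₃ + w₃) (u₄ + w₄) (u₅ + w₅)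
      ≈ combination q Ω Y u₁ u₂ u₃ u₄ u₅ + combination q Ω Y w₁ w₂ w₃ w₄ w₅
  combination-+ = solve 13 (λ q Ω Y u₁ u₂ u₃ u₄ u₅ w₁ w₂ w₃ w₄ w₅ →
    P.combination q Ω Y (u₁ :+ w₁) (u₂ :+ w₂) (u₃ :+ w₃) (u₄ :+ w₄) (u₅ :+ w₅)
      := P.combination q Ω Y u₁ u₂ u₃ u₄ u₅ :+ P.combination q Ω Y w₁ w₂ w₃ w₄ w₅) refl

  combination-*ʳ : ∀ q Ω Y u₁ u₂ u₃ u₄ u₅ w →
    combination q Ω Y (u₁ * w) (u₂ * w) (u₃ * w) (u₄ * w) (u₅ * w)
      ≈ combination q Ω Y u₁ u₂ u₃ u₄ u₅ * w
  combination-*ʳ = solve 9 (λ q Ω Y u₁ u₂ u₃ u₄ u₅ w →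
    P.combination q Ω Y (u₁ :* w) (u₂ :* w) (u₃ :* w) (u₄ :* w) (u₅ :* w)
      := P.combination q Ω Y u₁ u₂ u₃ u₄ u₅ :* w) refl

  series-combination : ∀ q Ω Y (a₁ a₂ a₃ a₄ a₅ : ℕ → Carrier) z N →
    combination q Ω Y (series a₁ z N) (series a₂ z N) (series a₃ z N) (series a₄ z N) (series a₅ z N)
      ≈ series (λ m → combination q Ω Y (a₁ m) (a₂ m) (a₃ m) (a₄ m) (a₅ m)) z N
  series-combination q Ω Y a₁ a₂ a₃ a₄ a₅ z zero    =
    combination-*ʳ q Ω Y (a₁ zero) (a₂ zero) (a₃ zero) (a₄ zero) (a₅ zero) (z ^ℕ zero)
  series-combination q Ω Y a₁ a₂ a₃ a₄ a₅ z (suc N) = begin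
    combination q Ω Y (S a₁ + a₁ (suc N) * zᴺ⁺¹) (S a₂ + a₂ (suc N) * zᴺ⁺¹) (S a₃ + a₃ (suc N) * zᴺ⁺¹)
                      (S a₄ + a₄ (suc N) * zᴺ⁺¹) (S a₅ + a₅ (suc N) * zᴺ⁺¹)
      ≈⟨ combination-+ q Ω Y _ _ _ _ _ _ _ _ _ _ ⟩
    combination q Ω Y (S a₁) (S a₂) (S a₃) (S a₄) (S a₅)
      + combination q Ω Y (a₁ (suc N) * zᴺ⁺¹) (a₂ (suc N) * zᴺ⁺¹) (a₃ (suc N) * zᴺ⁺¹)
                          (a₄ (suc N) * zᴺ⁺¹) (a₅ (suc N) * zᴺ⁺¹)
      ≈⟨ +-cong (series-combination q Ω Y a₁ a₂ a₃ a₄ a₅ z N)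
                (combination-*ʳ q Ω Y (a₁ (suc N)) (a₂ (suc N)) (a₃ (suc N)) (a₄ (suc N)) (a₅ (suc N))
                                zᴺ⁺¹) ⟩
    series (λ m → combination q Ω Y (a₁ m) (a₂ m) (a₃ m) (a₄ m) (a₅ m)) z (suc N) ∎
    where
    S : (ℕ → Carrier) → Carrier
    S a = series a z N
    zᴺ⁺¹ : Carrier
    zᴺ⁺¹ = z ^ℕ suc N

  lhs≈expansion : ∀ e q W Y T₀ T₁ T₂ → q * q * q * q * lhs e q W Y T₀ T₁ T₂ ≈ expansion e q W Y T₀ T₁ T₂
  lhs≈expansion = solve 7 (λ e q W Y T₀ T₁ T₂ →
    q :* q :* q :* q :* P.lhs e q W Y T₀ T₁ T₂ := P.expansion e q W Y T₀ T₁ T₂) refl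

  combination-bottom : ∀ q Ω Y → combination q Ω Y 0# 0# 0# 1# 1# ≈ 0#
  combination-bottom = solve 3 (λ q Ω Y →
    P.combination q Ω Y (con (+ 0)) (con (+ 0)) (con (+ 0)) (con (+ 1)) (con (+ 1)) := con (+ 0)) refl

  private
    residual≈0 : ∀ λ′ {l r} → l ≈ r → λ′ * (l - r) ≈ 0#
    residual≈0 λ′ l≈r = trans (*-congˡ (x≈y⇒x∙y⁻¹≈ε l≈r)) (zeroʳ λ′)

  combination-vanishes : ∀ q v Ω Y u₁ u₂ u₃ u₄ u₅ → clearing q v Ω Y ≉ 0# →
    u₁ * (Ω * q * q - 1#) ≈ u₃ * ((1# - v) * (1# - Y * q) * (Ω * q * q)) →
    u₂ * ((Ω * q * q - 1#) * (1# - Y * q * v)) ≈ u₃ * ((Ω * q * q - v * v) * (1# - Y * q)) →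
    u₄ * ((1# - q * v) * (1# - Y * q * v) * (Ω * q * q)) ≈ u₃ * (Ω * q * q - v * v) →
    u₅ * ((1# - q * v) * (1# - Y) * (Ω * q * q * q * q)) ≈ u₃ * (Ω * q * q * q * q - 1#) →
    combination q Ω Y u₁ u₂ u₃ u₄ u₅ ≈ 0#
  combination-vanishes q v Ω Y u₁ u₂ u₃ u₄ u₅ clearing≉0 u₁-relation u₂-relation u₄-relation u₅-relation =
    x*y≈0⇒y≈0 clearing≉0 (begin
      clearing q v Ω Y * combination q Ω Y u₁ u₂ u₃ u₄ u₅
        ≈⟨ solve 9 (λ q v Ω Y u₁ u₂ u₃ u₄ u₅ →
             P.clearing q v Ω Y :* P.combination q Ω Y u₁ u₂ u₃ u₄ u₅
               := P.certificate q v Ω Y u₁ u₂ u₃ u₄ u₅)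
           refl q v Ω Y u₁ u₂ u₃ u₄ u₅ ⟩
      certificate q v Ω Y u₁ u₂ u₃ u₄ u₅
        ≈⟨ +-cong (+-cong (+-cong (residual≈0 _ u₁-relation) (residual≈0 _ u₂-relation))
                          (residual≈0 _ u₄-relation))
                  (residual≈0 _ u₅-relation) ⟩
      0# + 0# + 0# + 0#
        ≈⟨ trans (+-identityʳ _) (trans (+-identityʳ _) (+-identityʳ _)) ⟩
      0# ∎)

  combination-vanishesᵗᵒᵖ : ∀ q W Y u₁ u₃ u₅ → clearingᵗᵒᵖ q W Y ≉ 0# →
    u₁ * (W * W * q * q - 1#) ≈ u₃ * ((1# - W * q) * (1# - Y * q) * (W * W * q * q)) →
    u₅ * ((1# - q * (W * q)) * (1# - Y) * (W * W * q * q * q * q)) ≈ u₃ * (W * W * q * q * q * q - 1#) →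
    combination q (W * W) Y u₁ 0# u₃ 0# u₅ ≈ 0#
  combination-vanishesᵗᵒᵖ q W Y u₁ u₃ u₅ clearing≉0 u₁-relation u₅-relation =
    x*y≈0⇒y≈0 clearing≉0 (begin
      clearingᵗᵒᵖ q W Y * combination q (W * W) Y u₁ 0# u₃ 0# u₅
        ≈⟨ solve 6 (λ q W Y u₁ u₃ u₅ →
             P.clearingᵗᵒᵖ q W Y :* P.combination q (W :* W) Y u₁ (con (+ 0)) u₃ (con (+ 0)) u₅
               := P.certificateᵗᵒᵖ q W Y u₁ u₃ u₅)
           refl q W Y u₁ u₃ u₅ ⟩
      certificateᵗᵒᵖ q W Y u₁ u₃ u₅
        ≈⟨ +-cong (residual≈0 _ u₁-relation) (residual≈0 _ u₅-relation) ⟩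
      0# + 0#
        ≈⟨ +-identityʳ 0# ⟩
      0# ∎)

module Instantiation {c ℓ : Level} (F : Field c ℓ) where
  open Field F hiding (zero)
  open FieldDefs F
  open FieldProperties F
  open Powers F
  open Pochhammer F
  open Series F
  open Coefficients F
  open Polynomials rawRing using (combination; lhs; expansion; clearing; clearingᵗᵒᵖ)
  open IntegerCoefficients commutativeRing using (solve; _:=_; _:*_; _:-_; con)
  open import Algebra.Properties.CommutativeSemigroup *-commutativeSemigroup using (xy∙z≈y∙xz)
  open import Relation.Binary.Reasoning.Setoid setoid

  module Setting
    (q : Carrier) (q≉0 : q ≉ 0#) (no-root : ∀ j → 0 < j → q ^ℕ j ≉ 1#) (r s : ℤ) (n : ℕ)
    (h₂ : ∀ k → k ≤ suc n → poch (q ^ℤ (r ℤ.- + n)) q k ≉ 0#)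
    (h₃ : ∀ k → k ≤ suc (suc n) → poch (q ^ℤ ((r ℤ.- + n) ℤ.- + 1)) q k ≉ 0#) where

    open HypergeometricTerm F q

    b : Carrier
    b = q ^ℕ 2

    U V : ℕ → Carrier
    U m = q ^ℤ (ℤ.- (+ (2 ℕ.* m)))
    V m = q ^ℤ ((+ 1 ℤ.+ r) ℤ.- + m)

    t : ℕ → ℕ → Carrier
    t m = term b (U m) (V m)

    t₀ t₁ t₂ : ℕ → Carrier
    t₀ = t n
    t₁ = t (suc n)
    t₂ = t (suc (suc n))

    W Ω Y e ζ : Carrier
    W = q ^ℕ n
    Ω = W * W
    Y = q ^ℤ ((r ℤ.- + n) ℤ.- + 1)
    e = q ^ℤ ((ℤ.- s) ℤ.- + 1)
    ζ = e * q * q * q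

    T₀ T₁ T₂ : Carrier
    T₀ = T q r n s
    T₁ = T q r (suc n) s
    T₂ = T q r (suc (suc n)) s

    LHS : Carrier
    LHS = (q ^ℤ (ℤ.- s)) * (1# - q ^ℕ (2 ℕ.* n ℕ.+ 2)) * (q ^ℤ (ℤ.- s) + q ^ℤ (r ℤ.+ + n)) * T₀
      + (q ^ℕ n) * (q ^ℕ n - q ^ℤ r)
          * (- (q ^ℕ (2 ℕ.* n ℕ.+ 1)) + q ^ℤ (r ℤ.+ + n) + q ^ℤ (ℤ.- s) + q ^ℤ ((ℤ.- s) ℤ.- + 1)) * T₁
      + (q ^ℕ (2 ℕ.* n)) * (q ^ℕ n - q ^ℤ r) * (q ^ℕ (suc n) - q ^ℤ r) * T₂

    -- Exponents are stated in M = + m and N = + n, so that + (2 ℕ.* m) unfolds to M ℤ.+ (M ℤ.+ + 0)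
    -- and the integer ring solver applies.
    private
      exponent-U : ∀ M → ℤ.- ((+ 1 ℤ.+ M) ℤ.+ ((+ 1 ℤ.+ M) ℤ.+ + 0)) ℤ.+ + 2 ≡ ℤ.- (M ℤ.+ (M ℤ.+ + 0))
      exponent-U = solve-∀
      exponent-V : ∀ r M → ((+ 1 ℤ.+ r) ℤ.- (+ 1 ℤ.+ M)) ℤ.+ + 1 ≡ (+ 1 ℤ.+ r) ℤ.- M
      exponent-V = solve-∀
      exponent-Ω : ∀ N → ℤ.- (N ℤ.+ (N ℤ.+ + 0)) ℤ.+ (N ℤ.+ N) ≡ + 0
      exponent-Ω = solve-∀
      exponent-Y : ∀ r N → (+ 1 ℤ.+ r) ℤ.- (+ 1 ℤ.+ (+ 1 ℤ.+ N)) ≡ (r ℤ.- N) ℤ.- + 1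
      exponent-Y = solve-∀
      exponent-h₂ : ∀ r N → (+ 1 ℤ.+ r) ℤ.- (+ 1 ℤ.+ N) ≡ r ℤ.- N
      exponent-h₂ = solve-∀
      exponent-R : ∀ r N → (+ 1 ℤ.+ N) ℤ.+ ((r ℤ.- N) ℤ.- + 1) ≡ r
      exponent-R = solve-∀
      exponent-e : ∀ s → ((ℤ.- s) ℤ.- + 1) ℤ.+ + 1 ≡ ℤ.- s
      exponent-e = solve-∀
      exponent-ζ : ∀ s → ((ℤ.- s) ℤ.- + 1) ℤ.+ + 3 ≡ + 2 ℤ.- s
      exponent-ζ = solve-∀

    U-shift : ∀ m → U (suc m) * b ≈ U m
    U-shift m = ^ℤ-+-≡ q≉0 (ℤ.- (+ (2 ℕ.* suc m))) (+ 2) (exponent-U (+ m))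

    V-shift : ∀ m → V (suc m) * q ≈ V m
    V-shift m = trans (*-congˡ (sym (*-identityˡ q)))
                      (^ℤ-+-≡ q≉0 ((+ 1 ℤ.+ r) ℤ.- + suc m) (+ 1) (exponent-V r (+ m)))

    V₁≡ : V (suc n) ≡ q ^ℤ (r ℤ.- + n)
    V₁≡ = ≡.cong (q ^ℤ_) (exponent-h₂ r (+ n))

    V₂≡Y : V (suc (suc n)) ≡ Y
    V₂≡Y = ≡.cong (q ^ℤ_) (exponent-Y r (+ n))

    V₁≈Yq : V (suc n) ≈ Y * q
    V₁≈Yq = trans (sym (V-shift (suc n))) (*-congʳ (reflexive V₂≡Y))

    U₀Ω≈1 : U n * Ω ≈ 1#
    U₀Ω≈1 = trans (*-congˡ (sym (^ℕ-+ q n n)))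
                  (^ℤ-+-≡ q≉0 (ℤ.- (+ (2 ℕ.* n))) (+ n ℤ.+ + n) (exponent-Ω (+ n)))

    U-suc : ∀ m P → U m * P ≈ 1# → U (suc m) * (P * q * q) ≈ 1#
    U-suc m P UP≈1 = begin
      U (suc m) * (P * q * q)   ≈⟨ solve 3 (λ u P q → u :* (P :* q :* q) := u :* (q :* q) :* P) refl (U (suc m)) P q ⟩
      U (suc m) * (q * q) * P   ≈⟨ *-congʳ (*-congˡ (*-congʳ (*-identityˡ q))) ⟨
      U (suc m) * b * P         ≈⟨ *-congʳ (U-shift m) ⟩
      U m * P                   ≈⟨ UP≈1 ⟩
      1#                        ∎

    U₁Ωq²≈1 : U (suc n) * (Ω * q * q) ≈ 1#
    U₁Ωq²≈1 = U-suc n Ω U₀Ω≈1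

    U₂Ωq⁴≈1 : U (suc (suc n)) * (Ω * q * q * q * q) ≈ 1#
    U₂Ωq⁴≈1 = U-suc (suc n) (Ω * q * q) U₁Ωq²≈1

    bʲ≈qʲqʲ : ∀ j → b ^ℕ j ≈ q ^ℕ j * q ^ℕ j
    bʲ≈qʲqʲ j = trans (^ℕ-cong j (*-congʳ (*-identityˡ q))) (^ℕ-distrib-* q q j)

    q²ⁿ≈Ω : q ^ℕ (2 ℕ.* n) ≈ Ω
    q²ⁿ≈Ω = trans (^ℕ-+ q n (n ℕ.+ 0)) (*-congˡ (reflexive (≡.cong (q ^ℕ_) (ℕ.+-identityʳ n))))

    q²ⁿ⁺¹≈Ωq : q ^ℕ (2 ℕ.* n ℕ.+ 1) ≈ Ω * q
    q²ⁿ⁺¹≈Ωq = trans (^ℕ-+ q (2 ℕ.* n) 1) (*-cong q²ⁿ≈Ω (*-identityˡ q))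

    q²ⁿ⁺²≈Ωq² : q ^ℕ (2 ℕ.* n ℕ.+ 2) ≈ Ω * q * q
    q²ⁿ⁺²≈Ωq² = trans (^ℕ-+ q (2 ℕ.* n) 2)
                      (trans (*-cong q²ⁿ≈Ω (*-congʳ (*-identityˡ q))) (sym (*-assoc _ _ _)))

    qʳ≈WqY : q ^ℤ r ≈ W * q * Y
    qʳ≈WqY = sym (^ℤ-+-≡ q≉0 (+ suc n) ((r ℤ.- + n) ℤ.- + 1) (exponent-R r (+ n)))

    qʳ⁺ⁿ≈WqYW : q ^ℤ (r ℤ.+ + n) ≈ W * q * Y * W
    qʳ⁺ⁿ≈WqYW = trans (^ℤ-+ q≉0 r (+ n)) (*-congʳ qʳ≈WqY)

    q⁻ˢ≈eq : q ^ℤ (ℤ.- s) ≈ e * q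
    q⁻ˢ≈eq = sym (trans (*-congˡ (sym (*-identityˡ q)))
                        (^ℤ-+-≡ q≉0 ((ℤ.- s) ℤ.- + 1) (+ 1) (exponent-e s)))

    q²⁻ˢ≈ζ : q ^ℤ (+ 2 ℤ.- s) ≈ ζ
    q²⁻ˢ≈ζ = begin
      q ^ℤ (+ 2 ℤ.- s)       ≈⟨ ^ℤ-+-≡ q≉0 ((ℤ.- s) ℤ.- + 1) (+ 3) (exponent-ζ s) ⟨
      e * (1# * q * q * q)   ≈⟨ solve 2 (λ e q → e :* (con (+ 1) :* q :* q :* q) := e :* q :* q :* q) refl e q ⟩
      e * q * q * q          ∎

    LHS≈lhs : LHS ≈ lhs e q W Y T₀ T₁ T₂
    LHS≈lhs =
      +-cong (+-cong (*-congʳ (*-cong (*-cong q⁻ˢ≈eq (+-congˡ (-‿cong q²ⁿ⁺²≈Ωq²))) (+-cong q⁻ˢ≈eq qʳ⁺ⁿ≈WqYW)))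
                     (*-congʳ (*-cong (*-congˡ (+-congˡ (-‿cong qʳ≈WqY)))
                                      (+-congʳ (+-cong (+-cong (-‿cong q²ⁿ⁺¹≈Ωq) qʳ⁺ⁿ≈WqYW) q⁻ˢ≈eq)))))
             (*-congʳ (*-cong (*-cong q²ⁿ≈Ω (+-congˡ (-‿cong qʳ≈WqY))) (+-congˡ (-‿cong qʳ≈WqY))))

    den₁≉0 : ∀ k → k ≤ suc n → denominator (V (suc n)) k ≉ 0#
    den₁≉0 k k≤ = *-≉0 (poch-q-≉0 no-root k) (≡.subst (λ y → poch y q k ≉ 0#) (≡.sym V₁≡) (h₂ k k≤))

    den₂≉0 : ∀ k → k ≤ suc (suc n) → denominator (V (suc (suc n))) k ≉ 0#
    den₂≉0 k k≤ = *-≉0 (poch-q-≉0 no-root k) (≡.subst (λ y → poch y q k ≉ 0#) (≡.sym V₂≡Y) (h₃ k k≤))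

    t₀-vanishes : t₀ (suc n) ≈ 0#
    t₀-vanishes = term-≈0 (V n) n (trans (*-congˡ (bʲ≈qʲqʲ n)) U₀Ω≈1)

    t₁-vanishes : t₁ (suc (suc n)) ≈ 0#
    t₁-vanishes = term-≈0 (V (suc n)) (suc n) (trans (*-congˡ bⁿ⁺¹≈Ωq²) U₁Ωq²≈1)
      where
      bⁿ⁺¹≈Ωq² : b ^ℕ suc n ≈ Ω * q * q
      bⁿ⁺¹≈Ωq² = trans (bʲ≈qʲqʲ (suc n))
                       (solve 2 (λ W q → W :* q :* (W :* q) := W :* W :* q :* q) refl W q)

    shift-t₀-relation : ∀ j → j ≤ suc n →
      shift t₀ j * (Ω * q * q - 1#) ≈ t₁ j * ((1# - q ^ℕ j) * (1# - Y * q) * (Ω * q * q))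
    shift-t₀-relation zero    _         =
      solve 4 (λ A t B C → con (+ 0) :* A := t :* ((con (+ 1) :- con (+ 1)) :* B :* C))
        refl (Ω * q * q - 1#) (t₁ zero) (1# - Y * q) (Ω * q * q)
    shift-t₀-relation (suc i) (s≤s i≤n) = begin
      t₀ i * (Ω * q * q - 1#)
        ≈⟨ *-congˡ ([1-u]*p≈p-1 U₁Ωq²≈1) ⟨
      t₀ i * ((1# - U (suc n)) * (Ω * q * q))
        ≈⟨ xy∙z≈y∙xz (1# - U (suc n)) (t₀ i) (Ω * q * q) ⟨
      (1# - U (suc n)) * t₀ i * (Ω * q * q)
        ≈⟨ *-congʳ (term-shift i (U-shift n) (V-shift n) (den₁≉0 (suc i) (s≤s i≤n))) ⟨
      t₁ (suc i) * ((1# - q * q ^ℕ i) * (1# - V (suc n))) * (Ω * q * q)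
        ≈⟨ *-congʳ (*-congˡ (*-cong (+-congˡ (-‿cong (*-comm q _))) (+-congˡ (-‿cong V₁≈Yq)))) ⟩
      t₁ (suc i) * ((1# - q ^ℕ suc i) * (1# - Y * q)) * (Ω * q * q)
        ≈⟨ *-assoc _ _ _ ⟩
      t₁ (suc i) * ((1# - q ^ℕ suc i) * (1# - Y * q) * (Ω * q * q))
        ∎

    t₀-relation : ∀ j → j ≤ n →
      t₀ j * ((Ω * q * q - 1#) * (1# - Y * q * q ^ℕ j))
        ≈ t₁ j * ((Ω * q * q - q ^ℕ j * q ^ℕ j) * (1# - Y * q))
    t₀-relation j j≤n = begin
      t₀ j * ((Ω * q * q - 1#) * (1# - Y * q * q ^ℕ j))
        ≈⟨ *-congˡ (*-cong ([1-u]*p≈p-1 U₁Ωq²≈1) (+-congˡ (-‿cong (*-congʳ V₁≈Yq)))) ⟨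
      t₀ j * ((1# - U (suc n)) * (Ω * q * q) * (1# - V (suc n) * q ^ℕ j))
        ≈⟨ trans (x*[y*z]*w≈x*[y*w]*z (t₀ j) (1# - U (suc n)) (1# - V (suc n) * q ^ℕ j) (Ω * q * q))
                 (*-assoc _ _ _) ⟨
      t₀ j * ((1# - U (suc n)) * (1# - V (suc n) * q ^ℕ j)) * (Ω * q * q)
        ≈⟨ *-congʳ (term-contiguous j (U-shift n) (V-shift n) (den₁≉0 (suc j) (s≤s j≤n))) ⟩
      t₁ j * ((1# - U (suc n) * b ^ℕ j) * (1# - V (suc n))) * (Ω * q * q)
        ≈⟨ trans (x*[y*z]*w≈x*[y*w]*z (t₁ j) (1# - U (suc n) * b ^ℕ j) (1# - V (suc n)) (Ω * q * q))
                 (*-assoc _ _ _) ⟩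
      t₁ j * ((1# - U (suc n) * b ^ℕ j) * (Ω * q * q) * (1# - V (suc n)))
        ≈⟨ *-congˡ (*-cong (trans ([1-u*w]*p≈p-w (b ^ℕ j) U₁Ωq²≈1) (+-congˡ (-‿cong (bʲ≈qʲqʲ j))))
                           (+-congˡ (-‿cong V₁≈Yq))) ⟩
      t₁ j * ((Ω * q * q - q ^ℕ j * q ^ℕ j) * (1# - Y * q))
        ∎

    t₁-relation : ∀ j → j ≤ n →
      t₁ (suc j) * ((1# - q * q ^ℕ j) * (1# - Y * q * q ^ℕ j) * (Ω * q * q))
        ≈ t₁ j * (Ω * q * q - q ^ℕ j * q ^ℕ j)
    t₁-relation j j≤n = begin
      t₁ (suc j) * ((1# - q * q ^ℕ j) * (1# - Y * q * q ^ℕ j) * (Ω * q * q))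
        ≈⟨ *-congˡ (*-congʳ (*-congˡ (+-congˡ (-‿cong (*-congʳ V₁≈Yq))))) ⟨
      t₁ (suc j) * ((1# - q * q ^ℕ j) * (1# - V (suc n) * q ^ℕ j) * (Ω * q * q))
        ≈⟨ *-assoc _ _ _ ⟨
      t₁ (suc j) * ((1# - q * q ^ℕ j) * (1# - V (suc n) * q ^ℕ j)) * (Ω * q * q)
        ≈⟨ *-congʳ (term-suc b (U (suc n)) (V (suc n)) j (den₁≉0 (suc j) (s≤s j≤n))) ⟩
      (1# - U (suc n) * b ^ℕ j) * t₁ j * (Ω * q * q)
        ≈⟨ xy∙z≈y∙xz (1# - U (suc n) * b ^ℕ j) (t₁ j) (Ω * q * q) ⟩
      t₁ j * ((1# - U (suc n) * b ^ℕ j) * (Ω * q * q))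
        ≈⟨ *-congˡ (trans ([1-u*w]*p≈p-w (b ^ℕ j) U₁Ωq²≈1) (+-congˡ (-‿cong (bʲ≈qʲqʲ j)))) ⟩
      t₁ j * (Ω * q * q - q ^ℕ j * q ^ℕ j)
        ∎

    t₂-relation : ∀ j → j ≤ suc n →
      t₂ (suc j) * ((1# - q * q ^ℕ j) * (1# - Y) * (Ω * q * q * q * q)) ≈ t₁ j * (Ω * q * q * q * q - 1#)
    t₂-relation j j≤ = begin
      t₂ (suc j) * ((1# - q * q ^ℕ j) * (1# - Y) * (Ω * q * q * q * q))
        ≈⟨ *-congˡ (*-congʳ (*-congˡ (+-congˡ (-‿cong (reflexive V₂≡Y))))) ⟨
      t₂ (suc j) * ((1# - q * q ^ℕ j) * (1# - V (suc (suc n))) * (Ω * q * q * q * q))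
        ≈⟨ *-assoc _ _ _ ⟨
      t₂ (suc j) * ((1# - q * q ^ℕ j) * (1# - V (suc (suc n)))) * (Ω * q * q * q * q)
        ≈⟨ *-congʳ (term-shift j (U-shift (suc n)) (V-shift (suc n)) (den₂≉0 (suc j) (s≤s j≤))) ⟩
      (1# - U (suc (suc n))) * t₁ j * (Ω * q * q * q * q)
        ≈⟨ xy∙z≈y∙xz (1# - U (suc (suc n))) (t₁ j) (Ω * q * q * q * q) ⟩
      t₁ j * ((1# - U (suc (suc n))) * (Ω * q * q * q * q))
        ≈⟨ *-congˡ ([1-u]*p≈p-1 U₂Ωq⁴≈1) ⟩
      t₁ j * (Ω * q * q * q * q - 1#)
        ∎

    Ωq²-1≉0 : Ω * q * q - 1# ≉ 0#
    Ωq²-1≉0 = x≉1⇒x-1≉0 (λ Ωq²≈1 →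
      no-root (2 ℕ.* n ℕ.+ 2) (ℕ.≤-trans (s≤s z≤n) (ℕ.m≤n+m 2 (2 ℕ.* n))) (trans q²ⁿ⁺²≈Ωq² Ωq²≈1))

    1-q^[1+j]≉0 : ∀ j → 1# - q * q ^ℕ j ≉ 0#
    1-q^[1+j]≉0 j = *-≉0ʳ (poch-q-≉0 no-root (suc j))

    1-Y≉0 : 1# - Y ≉ 0#
    1-Y≉0 = ≉0-resp (+-congˡ (-‿cong (*-identityʳ Y))) (*-≉0ʳ (h₃ 1 (s≤s z≤n)))

    1-Yq^[1+j]≉0 : ∀ j → j ≤ n → 1# - Y * q * q ^ℕ j ≉ 0#
    1-Yq^[1+j]≉0 j j≤n =
      ≉0-resp (+-congˡ (-‿cong (*-congʳ V₁≈Yq))) (*-≉0ʳ (*-≉0ʳ (den₁≉0 (suc j) (s≤s j≤n))))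

    Ωq⁴≉0 : Ω * q * q * q * q ≉ 0#
    Ωq⁴≉0 = *-≉0 (*-≉0 (*-≉0 (*-≉0 (*-≉0 W≉0 W≉0) q≉0) q≉0) q≉0) q≉0
      where
      W≉0 : W ≉ 0#
      W≉0 = ^ℕ-≉0 n q≉0

    clearing≉0 : ∀ j → j ≤ n → clearing q (q ^ℕ j) Ω Y ≉ 0#
    clearing≉0 j j≤n = *-≉0 (*-≉0 (*-≉0 (*-≉0 Ωq²-1≉0 (1-q^[1+j]≉0 j)) 1-Y≉0) (1-Yq^[1+j]≉0 j j≤n)) Ωq⁴≉0

    clearingᵗᵒᵖ≉0 : clearingᵗᵒᵖ q W Y ≉ 0#
    clearingᵗᵒᵖ≉0 = *-≉0 (*-≉0 (*-≉0 Ωq²-1≉0 (1-q^[1+j]≉0 (suc n))) 1-Y≉0) Ωq⁴≉0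

    coefficient : ℕ → Carrier
    coefficient m = combination q Ω Y (shift (shift t₀) m) (shift t₀ m) (shift t₁ m) (t₁ m) (t₂ m)

    coefficient-≈0 : ∀ m → m ≤ suc (suc n) → coefficient m ≈ 0#
    coefficient-≈0 zero    _ =
      trans (combination-cong q Ω Y refl refl refl (term-zero b (U (suc n)) (V (suc n)))
                                                   (term-zero b (U (suc (suc n))) (V (suc (suc n)))))
            (combination-bottom q Ω Y)
    coefficient-≈0 (suc j) (s≤s j≤1+n) with ℕ.m≤n⇒m<n∨m≡n j≤1+n
    ... | inj₁ (s≤s j≤n) =
      combination-vanishes q (q ^ℕ j) Ω Y (shift t₀ j) (t₀ j) (t₁ j) (t₁ (suc j)) (t₂ (suc j))
        (clearing≉0 j j≤n)
        (shift-t₀-relation j (ℕ.m≤n⇒m≤1+n j≤n)) (t₀-relation j j≤n) (t₁-relation j j≤n)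
        (t₂-relation j (ℕ.m≤n⇒m≤1+n j≤n))
    ... | inj₂ ≡.refl = begin
      coefficient (suc (suc n))
        ≈⟨ combination-cong q Ω Y refl t₀-vanishes refl t₁-vanishes refl ⟩
      combination q Ω Y (t₀ n) 0# (t₁ (suc n)) 0# (t₂ (suc (suc n)))
        ≈⟨ combination-vanishesᵗᵒᵖ q W Y (t₀ n) (t₁ (suc n)) (t₂ (suc (suc n))) clearingᵗᵒᵖ≉0
             (shift-t₀-relation (suc n) ℕ.≤-refl) (t₂-relation (suc n) ℕ.≤-refl) ⟩
      0# ∎

    T-series : ∀ m → T q r m s ≈ series (t m) ζ m
    T-series m = sumTo-cong m (λ k _ → *-congˡ (trans (^ℤ-*-+ q≉0 (+ 2 ℤ.- s) k) (^ℕ-cong k q²⁻ˢ≈ζ)))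

    expansion≈series : expansion e q W Y T₀ T₁ T₂ ≈ series coefficient ζ (suc (suc n))
    expansion≈series =
      trans (combination-cong q Ω Y ζ²T₀≈ ζT₀≈ ζT₁≈ T₁≈ (T-series (suc (suc n))))
            (series-combination q Ω Y (shift (shift t₀)) (shift t₀) (shift t₁) t₁ t₂ ζ (suc (suc n)))
      where
      ζT₀≈series : ζ * T₀ ≈ series (shift t₀) ζ (suc n)
      ζT₀≈series = trans (*-congˡ (T-series n)) (series-shift t₀ ζ n)

      ζ²T₀≈ : ζ * (ζ * T₀) ≈ series (shift (shift t₀)) ζ (suc (suc n))
      ζ²T₀≈ = trans (*-congˡ ζT₀≈series) (series-shift (shift t₀) ζ (suc n))

      ζT₀≈ : ζ * T₀ ≈ series (shift t₀) ζ (suc (suc n))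
      ζT₀≈ = trans ζT₀≈series (sym (series-extend (shift t₀) ζ (suc n) t₀-vanishes))

      ζT₁≈ : ζ * T₁ ≈ series (shift t₁) ζ (suc (suc n))
      ζT₁≈ = trans (*-congˡ (T-series (suc n))) (series-shift t₁ ζ (suc n))

      T₁≈ : T₁ ≈ series t₁ ζ (suc (suc n))
      T₁≈ = trans (T-series (suc n)) (sym (series-extend t₁ ζ (suc n) t₁-vanishes))

lemma2p2 : ∀ {c ℓ : Level} (F : Field c ℓ) → let open Field F in let open FieldDefs F in
    (q : Carrier) → ¬ (q ≈ 0#) → (∀ (j : ℕ) → 0 < j → ¬ ((q ^ℕ j) ≈ 1#)) →
    (r s : ℤ) (n : ℕ) →
    (∀ (k : ℕ) → k ≤ n → ¬ (poch (q ^ℤ ((+ 1 ℤ.+ r) ℤ.- + n)) q k ≈ 0#)) →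
    (∀ (k : ℕ) → k ≤ suc n → ¬ (poch (q ^ℤ (r ℤ.- + n)) q k ≈ 0#)) →
    (∀ (k : ℕ) → k ≤ suc (suc n) → ¬ (poch (q ^ℤ ((r ℤ.- + n) ℤ.- + 1)) q k ≈ 0#)) →
    ((q ^ℤ (ℤ.- s)) * (1# - q ^ℕ (2 ℕ.* n ℕ.+ 2)) * (q ^ℤ (ℤ.- s) + q ^ℤ (r ℤ.+ + n)) * T q r n s
      + (q ^ℕ n) * (q ^ℕ n - q ^ℤ r)
          * (- (q ^ℕ (2 ℕ.* n ℕ.+ 1)) + q ^ℤ (r ℤ.+ + n) + q ^ℤ (ℤ.- s) + q ^ℤ ((ℤ.- s) ℤ.- + 1))
          * T q r (suc n) s
      + (q ^ℕ (2 ℕ.* n)) * (q ^ℕ n - q ^ℤ r) * (q ^ℕ (suc n) - q ^ℤ r) * T q r (suc (suc n)) s)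
    ≈ 0#
lemma2p2 F q q≉0 no-root r s n _ h₂ h₃ = x*y≈0⇒y≈0 q⁴≉0 (begin
    q * q * q * q * LHS                      ≈⟨ *-congˡ LHS≈lhs ⟩
    q * q * q * q * lhs e q W Y T₀ T₁ T₂     ≈⟨ lhs≈expansion e q W Y T₀ T₁ T₂ ⟩
    expansion e q W Y T₀ T₁ T₂               ≈⟨ expansion≈series ⟩
    series coefficient ζ (suc (suc n))       ≈⟨ series-≈0 ζ (suc (suc n)) coefficient-≈0 ⟩
    0#                                       ∎)
  where
  open Field F hiding (zero)
  open FieldProperties F using (x*y≈0⇒y≈0; *-≉0)
  open Series F using (series; series-≈0)
  open Coefficients F using (lhs≈expansion)
  open Polynomials (Field.rawRing F) using (lhs; expansion)
  open Instantiation.Setting F q q≉0 no-root r s n h₂ h₃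
  open import Relation.Binary.Reasoning.Setoid setoid

  q⁴≉0 : q * q * q * q ≉ 0#
  q⁴≉0 = *-≉0 (*-≉0 (*-≉0 q≉0 q≉0) q≉0) q≉0
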